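{- Let $\mathbb{H}$ be a $\tau$-structure with universe $H$ and let $J\subseteq H$. Assume that $\mathbb{H}$ is $J$-non-foldable, and let $U$ be a cofinite subset of $T_{\mathbb{H}}$ containing $\rho_{\mathbb{H}}^{ -1}(J)$. Then every homomorphism in $\mathrm{Hom}(\mathbb{T}_{\mathbb{H}},\mathbb{H})$ that agrees with $\rho_{\mathbb{H}}$ on $U$ is equal to $\rho_{\mathbb{H}}$.
   Context: A signature $\tau$ is a set of relation symbols with arities; a $\tau$-structure $\mathbb{H}$ has a countable universe $H$ and relations $R(\mathbb{H})\subseteq H^k$ for $k$-ary $R\in\tau$. Homomorphisms $\mathbb{G}\to\mathbb{H}$ are maps $G\to H$ sending tuples of each $R(\mathbb{G})$ (componentwise) into $R(\mathbb{H})$. $b$ dominates $a$ in $\mathbb{H}$ if for every $k$-ary $R$, every $i$, and every $(a_1,\dots,a_k)\in R(\mathbb{H})$ with $a_i=a$, $(a_1,\dots,a_{i-1},b,a_{i+1},\dots,a_k)\in R(\mathbb{H})$; $a$ is dominated if it is dominated by some $b\neq a$. $\mathbb{H}$ is $J$-non-foldable if every dominated element of $\mathbb{H}$ lies in $J$. A walk in $\mathbb{H}$ is a sequence $a_0,i_1,(R_1,\mathbf{a}_1),j_1,a_1,\dots,a_{n-1},i_n,(R_n,\mathbf{a}_n),j_n,a_n$ ($n\ge0$ its length) with $R_\ell\in\tau$, $\mathbf{a}_\ell\in R_\ell(\mathbb{H})$, $i_\ell\neq j_\ell$, $a_{\ell-1}$ the $i_\ell$-th entry and $a_\ell$ the $j_\ell$-th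 entry of $\mathbf{a}_\ell$; $a_n$ is its ending point. The forest of walks $\mathbb{T}_{\mathbb{H}}$ is the $\tau$-structure with universe $T_{\mathbb{H}}$ = the set of all walks in $\mathbb{H}$, where for each $k$-ary $R$, $R(\mathbb{T}_{\mathbb{H}})$ consists of the tuples $(w_1,\dots,w_{i-1},w,w_{i+1},\dots,w_k)$ for every $\mathbf{a}=(a_1,\dots,a_k)\in R(\mathbb{H})$, every $1\le i\le k$ and every walk $w$ ending at $a_i$, with $w_j$ ($j\neq i$) the walk obtained by extending $w$ by $i,(R,\mathbf{a}),j,a_j$. The label map $\rho_{\mathbb{H}}:T_{\mathbb{H}}\to H$ sends each walk to its ending point; it is a homomorphism $\mathbb{T}_{\mathbb{H}}\to\mathbb{H}$. -}

module Defs where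

open import Data.Nat using (ℕ)
open import Data.Fin using (Fin; _≟_)
open import Data.Vec using (Vec; lookup; tabulate; map; _[_]≔_)
open import Data.Product using (Σ; _×_; _,_; proj₁; ∃-syntax)
open import Data.List using (List)
open import Data.List.Membership.Propositional using (_∈_)
open import Relation.Nullary using (¬_; yes; no)
open import Relation.Binary.PropositionalEquality using (_≡_; _≢_; refl)
open import Function.Definitions using (Injective)

record Signature : Set₁ where
  field
    Sym : Set
    ar  : Sym → ℕ

record Structure (τ : Signature) : Set₁ where
  open Signature τ
  field
    Carrier   : Set
    rel       : (R : Sym) → Vec Carrier (ar R) → Set
    countable : Σ (Carrier → ℕ) (λ f → Injective _≡_ _≡_ f)

module _ {τ : Signature} (𝐇 : Structure τ) where
  open Signature τ
  open Structure 𝐇 renaming (Carrier to H)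

  Dominates : H → H → Set
  Dominates b a = ∀ (R : Sym) (as : Vec H (ar R)) (i : Fin (ar R)) →
    rel R as → lookup as i ≡ a → rel R (as [ i ]≔ b)

  Dominated : H → Set
  Dominated a = ∃[ b ] (b ≢ a × Dominates b a)

  NonFoldable : (J : H → Set) → Set
  NonFoldable J = ∀ a → Dominated a → J a

  -- Proofs that the tuple is in the relation, that i ≠ j and that the
  -- previous endpoint is the i-th entry are irrelevant, so a walk is
  -- determined by its data a₀, i₁, (R₁,𝐚₁), j₁, a₁, …
  data WalkTo : H → Set where
    start : (a : H) → WalkTo a
    step  : ∀ {a} → WalkTo a → (R : Sym) (as : Vec H (ar R)) → .(rel R as) →
            (i j : Fin (ar R)) → .(i ≢ j) → .(lookup as i ≡ a) →
            WalkTo (lookup as j)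

  Walk : Set
  Walk = Σ H WalkTo

  ρ : Walk → H
  ρ = proj₁

  extTuple : (R : Sym) (as : Vec H (ar R)) → .(rel R as) →
             (i : Fin (ar R)) → WalkTo (lookup as i) → Vec Walk (ar R)
  extTuple R as m i w = tabulate f
    where
    f : Fin (ar R) → Walk
    f j with i ≟ j
    ... | yes _  = (lookup as i , w)
    ... | no i≢j = (lookup as j , step w R as m i j i≢j refl)

  TRel : (R : Sym) → Vec Walk (ar R) → Set
  TRel R ws = Σ (Vec H (ar R)) λ as → Σ (rel R as) λ m →
              Σ (Fin (ar R)) λ i → Σ (WalkTo (lookup as i)) λ w →
              ws ≡ extTuple R as m i w

  IsHomFromT : (Walk → H) → Set
  IsHomFromT h = ∀ (R : Sym) (ws : Vec Walk (ar R)) → TRel R ws → rel R (map h ws)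

  Cofinite : (Walk → Set) → Set
  Cofinite U = Σ (List Walk) λ L → ∀ w → ¬ U w → w ∈ L

module Submission where

-- If h agrees with ρ on every one-step extension of a walk w ending at a, then applying h to
-- the tuples of 𝕋_𝐇 in which w sits shows that h w dominates a. So h w ≠ a would make a
-- dominated, hence in J, hence w ∈ U and h w = a after all. Since the walks outside U have
-- bounded length, h agrees with ρ on all sufficiently long walks, and the previous step
-- propagates agreement down to every walk.

open import Defs
open import Data.Nat using (ℕ; zero; suc; _+_; _≤_; _<_)
open import Data.Nat.Properties using (+-identityʳ; +-suc; m≤n+m; <⇒≱) renaming (_≟_ to _≟ℕ_)
open import Data.Fin using (Fin; _≟_)
open import Data.Vec using (Vec; lookup; tabulate; map; _[_]≔_)
open import Data.Vec.Properties using (lookup∘tabulate; tabulate∘lookup; tabulate-cong; lookup-map; lookup∘update; lookup∘update′)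
open import Data.Product using (_,_; proj₁; proj₂)
open import Data.List using (List)
import Data.List as List
open import Data.List.Extrema.Nat using (max; xs≤max)
open import Data.List.Membership.Propositional using (_∈_)
open import Data.List.Membership.Propositional.Properties using (∈-map⁺)
import Data.List.Relation.Unary.All as All
open import Data.Empty using (⊥-elim)
open import Function using (_∘_)
open import Function.Bundles using (mk↣)
open import Relation.Nullary using (¬_; yes; no)
open import Relation.Nullary.Decidable using (via-injection; decidable-stable)
open import Relation.Binary.Definitions using (DecidableEquality)
open import Relation.Binary.PropositionalEquality using (_≡_; _≢_; refl; sym; cong; subst; module ≡-Reasoning)

lookup-≡tabulate : ∀ {A : Set} {n} {v : Vec A n} {F : Fin n → A} → v ≡ tabulate F → ∀ j → lookup v j ≡ F j
lookup-≡tabulate refl = lookup∘tabulate _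

module _ {τ : Signature} (𝐇 : Structure τ) where
  open Signature τ
  open Structure 𝐇 renaming (Carrier to H)

  _≟H_ : DecidableEquality H
  _≟H_ = via-injection (mk↣ (proj₂ countable)) _≟ℕ_

  length : ∀ {a} → WalkTo 𝐇 a → ℕ
  length (start _)              = 0
  length (step w _ _ _ _ _ _ _) = suc (length w)

  OnExtensions : (Walk 𝐇 → Set) → ∀ {a} → WalkTo 𝐇 a → Set
  OnExtensions P {a} w = ∀ R as (m : rel R as) i j (i≢j : i ≢ j) (e : lookup as i ≡ a) →
    P (lookup as j , step w R as m i j i≢j e)

  lookup-extTuple-self : ∀ R as m i (w : WalkTo 𝐇 (lookup as i)) →
    lookup (extTuple 𝐇 R as m i w) i ≡ (lookup as i , w)
  lookup-extTuple-self R as m i w with lookup-≡tabulate {v = extTuple 𝐇 R as m i w} refl i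
  ... | eq with i ≟ i
  ...   | yes _  = eq
  ...   | no i≢i = ⊥-elim (i≢i refl)

  lookup-extTuple-other : ∀ R as m i (w : WalkTo 𝐇 (lookup as i)) {j} (i≢j : i ≢ j) →
    lookup (extTuple 𝐇 R as m i w) j ≡ (lookup as j , step w R as m i j i≢j refl)
  lookup-extTuple-other R as m i w {j} i≢j with lookup-≡tabulate {v = extTuple 𝐇 R as m i w} refl j
  ... | eq with i ≟ j
  ...   | yes i≡j = ⊥-elim (i≢j i≡j)
  ...   | no _    = eq

  module _ {h : Walk 𝐇 → H} (hom : IsHomFromT 𝐇 h) where

    map-extTuple : ∀ R as m i (w : WalkTo 𝐇 (lookup as i)) → OnExtensions (λ v → h v ≡ ρ 𝐇 v) w →
      map h (extTuple 𝐇 R as m i w) ≡ as [ i ]≔ h (lookup as i , w)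
    map-extTuple R as m i w agree = begin
      map h (extTuple 𝐇 R as m i w)                     ≡⟨ sym (tabulate∘lookup _) ⟩
      tabulate (lookup (map h (extTuple 𝐇 R as m i w))) ≡⟨ tabulate-cong pointwise ⟩
      tabulate (lookup (as [ i ]≔ h (lookup as i , w))) ≡⟨ tabulate∘lookup _ ⟩
      as [ i ]≔ h (lookup as i , w)                     ∎
      where
      open ≡-Reasoning
      pointwise : ∀ j → lookup (map h (extTuple 𝐇 R as m i w)) j ≡ lookup (as [ i ]≔ h (lookup as i , w)) j
      pointwise j with i ≟ j
      ... | yes refl = begin
        lookup (map h (extTuple 𝐇 R as m i w)) i ≡⟨ lookup-map i h (extTuple 𝐇 R as m i w) ⟩
        h (lookup (extTuple 𝐇 R as m i w) i)     ≡⟨ cong h (lookup-extTuple-self R as m i w) ⟩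
        h (lookup as i , w)                      ≡⟨ sym (lookup∘update i as _) ⟩
        lookup (as [ i ]≔ h (lookup as i , w)) i ∎
      ... | no i≢j = begin
        lookup (map h (extTuple 𝐇 R as m i w)) j     ≡⟨ lookup-map j h (extTuple 𝐇 R as m i w) ⟩
        h (lookup (extTuple 𝐇 R as m i w) j)         ≡⟨ cong h (lookup-extTuple-other R as m i w i≢j) ⟩
        h (lookup as j , step w R as m i j i≢j refl) ≡⟨ agree R as m i j i≢j refl ⟩
        lookup as j                                  ≡⟨ sym (lookup∘update′ (i≢j ∘ sym) as _) ⟩
        lookup (as [ i ]≔ h (lookup as i , w)) j     ∎

    agreeOnExtensions⇒dominates : ∀ {a} (w : WalkTo 𝐇 a) → OnExtensions (λ v → h v ≡ ρ 𝐇 v) w →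
      Dominates 𝐇 (h (a , w)) a
    agreeOnExtensions⇒dominates w agree R as i m refl =
      subst (rel R) (map-extTuple R as m i w agree) (hom R _ (as , m , i , w , refl))

    agreeOnExtensions⇒agree : {J : H → Set} → NonFoldable 𝐇 J → (∀ w → J (ρ 𝐇 w) → h w ≡ ρ 𝐇 w) →
      ∀ {a} (w : WalkTo 𝐇 a) → OnExtensions (λ v → h v ≡ ρ 𝐇 v) w → h (a , w) ≡ a
    agreeOnExtensions⇒agree nonFoldable agreeOnJ {a} w agree with h (a , w) ≟H a
    ... | yes hw≡a = hw≡a
    ... | no  hw≢a =
      agreeOnJ (a , w) (nonFoldable a (h (a , w) , hw≢a , agreeOnExtensions⇒dominates w agree))

  lengthBound : List (Walk 𝐇) → ℕ
  lengthBound ws = max 0 (List.map (length ∘ proj₂) ws)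

  length≤lengthBound : ∀ {w ws} → w ∈ ws → length (proj₂ w) ≤ lengthBound ws
  length≤lengthBound {ws = ws} w∈ws =
    All.lookup (xs≤max 0 (List.map (length ∘ proj₂) ws)) (∈-map⁺ (length ∘ proj₂) w∈ws)

  long-walks-¬¬∈cofinite : {U : Walk 𝐇 → Set} (cofinite : Cofinite 𝐇 U) →
    ∀ w → lengthBound (proj₁ cofinite) < length (proj₂ w) → ¬ ¬ U w
  long-walks-¬¬∈cofinite (_ , ∉U⇒∈L) w bound<length ¬Uw =
    <⇒≱ bound<length (length≤lengthBound (∉U⇒∈L w ¬Uw))

  agreeOnCofinite⇒agreeOnLong : {U : Walk 𝐇 → Set} (cofinite : Cofinite 𝐇 U) {h : Walk 𝐇 → H} →
    (∀ w → U w → h w ≡ ρ 𝐇 w) → ∀ w → lengthBound (proj₁ cofinite) < length (proj₂ w) → h w ≡ ρ 𝐇 w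
  agreeOnCofinite⇒agreeOnLong cofinite {h} agreeOnU w long = decidable-stable (h w ≟H ρ 𝐇 w)
    (λ hw≢ρw → long-walks-¬¬∈cofinite cofinite w long (hw≢ρw ∘ agreeOnU w))

  descending-induction : (P : Walk 𝐇 → Set) (n : ℕ) → (∀ w → n < length (proj₂ w) → P w) →
    (∀ {a} (w : WalkTo 𝐇 a) → OnExtensions P w → P (a , w)) → ∀ w → P w
  descending-induction P n long ext w = go (suc n) w (m≤n+m (suc n) (length (proj₂ w)))
    where
    go : ∀ k w → n < length (proj₂ w) + k → P w
    go zero    w       n<ℓ = long w (subst (n <_) (+-identityʳ _) n<ℓ)
    go (suc k) (a , w) n<ℓ = ext w (λ _ _ _ _ _ _ _ → go k _ (subst (n <_) (+-suc (length w) k) n<ℓ))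

lemma2p2 : {τ : Signature} (𝐇 : Structure τ) (J : Structure.Carrier 𝐇 → Set) →
    NonFoldable 𝐇 J →
    (U : Walk 𝐇 → Set) → Cofinite 𝐇 U → (∀ w → J (ρ 𝐇 w) → U w) →
    (h : Walk 𝐇 → Structure.Carrier 𝐇) → IsHomFromT 𝐇 h →
    (∀ w → U w → h w ≡ ρ 𝐇 w) →
    ∀ w → h w ≡ ρ 𝐇 w
lemma2p2 𝐇 J nonFoldable U cofinite J⊆U h hom agreeOnU =
  descending-induction 𝐇 (λ w → h w ≡ ρ 𝐇 w) (lengthBound 𝐇 (proj₁ cofinite))
    (agreeOnCofinite⇒agreeOnLong 𝐇 cofinite agreeOnU)
    (agreeOnExtensions⇒agree 𝐇 hom nonFoldable (λ w → agreeOnU w ∘ J⊆U w))
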